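{- Let $N$ be a positive integer, let $k\ge 1$, and let $f_1,\ldots,f_k$ be functions defined on $\{1,\ldots,N\}$. Let $\mathbf{P}$ be the $N\times N$ lower triangular matrix all of whose entries on or below the diagonal equal $1$ (and all entries above the diagonal equal $0$). For a function $f$ on $\{1,\ldots,N\}$ let $\mathbf{S}_f$ be the $N\times N$ matrix with $(\mathbf{S}_f)_{i,j}=f(i)$ if $j\le i$ and $(\mathbf{S}_f)_{i,j}=0$ if $j>i$, and let $\mathbf{A}_f$ be the $N\times N$ matrix with $(\mathbf{A}_f)_{i,j}=f(i-1)$ if $j\le i-1$ and $(\mathbf{A}_f)_{i,j}=0$ otherwise (so the first row of $\mathbf{A}_f$ is zero; equivalently $\mathbf{A}_f=\mathbf{\Delta}\mathbf{S}_f$ where $\mathbf{\Delta}=(\delta_{i-1,j})_{N\times N}$). Then for every integer $m$ with $1\le m\le N$, \[ S(f_1,\ldots,f_k;N,m)=\Big(\mathbf{P}\cdot\prod_{l=1}^{k}\mathbf{S}_{f_l}\Big)_{N,m},\qquad A(f_1,\ldots,f_k;N,m)=\Big(\mathbf{P}\cdot\prod_{l=1}^{k}\mathbf{A}_{f_l}\Big)_{N,m}, \] where $\mathbf{M}_{i,j}$ denotes the entry in row $i$ and column $j$ of $\mathbf{M}$ and the products are taken in the order $l=1,2,\ldots,k$ from left to right.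
   Context: For positive integers $m,N$ and functions $f_1,\ldots,f_k$, the multiplicative nested sums are $S(f_1,\ldots,f_k;N,m):=\sum_{N\ge n_1\ge\cdots\ge n_k\ge m} f_1(n_1)\cdots f_k(n_k)$ and $A(f_1,\ldots,f_k;N,m):=\sum_{N> n_1>\cdots> n_k\ge m} f_1(n_1)\cdots f_k(n_k)$, where all $n_i$ are integers. Here $\delta_{a,b}=1$ if $a=b$ and $0$ otherwise. -}

module Defs where

open import Level using (Level)
open import Algebra.Bundles using (CommutativeRing)
open import Data.Nat using (ℕ; zero; suc; _≤?_)
open import Data.Fin using (Fin; toℕ)
open import Data.Vec using (Vec; []; _∷_)
open import Relation.Nullary.Decidable using (does)
open import Data.Bool using (if_then_else_)

module NestedSums {c ℓ : Level} (R : CommutativeRing c ℓ) where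
  open CommutativeRing R

  sumBelow : ℕ → (ℕ → Carrier) → Carrier
  sumBelow zero    g = 0#
  sumBelow (suc u) g = sumBelow u g + g u

  -- S(f₁,…,f_k; N, m) = Σ_{N ≥ n₁ ≥ ⋯ ≥ n_k ≥ m} f₁(n₁)⋯f_k(n_k), as an iterated sum
  -- (the empty list gives the empty product 1; only used with k ≥ 1)
  S : {k : ℕ} → Vec (ℕ → Carrier) k → ℕ → ℕ → Carrier
  S []       N m = 1#
  S (f ∷ fs) N m =
    sumBelow (suc N) (λ n → if does (m ≤? n) then f n * S fs n m else 0#)

  -- A(f₁,…,f_k; N, m) = Σ_{N > n₁ > ⋯ > n_k ≥ m} f₁(n₁)⋯f_k(n_k), as an iterated sum
  A : {k : ℕ} → Vec (ℕ → Carrier) k → ℕ → ℕ → Carrier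
  A []       N m = 1#
  A (f ∷ fs) N m =
    sumBelow N (λ n → if does (m ≤? n) then f n * A fs n m else 0#)

  -- N×N matrices; the Fin index i stands for the 1-based row/column toℕ i + 1
  Matrix : ℕ → Set c
  Matrix N = Fin N → Fin N → Carrier

  sumFin : {N : ℕ} → (Fin N → Carrier) → Carrier
  sumFin {zero}  g = 0#
  sumFin {suc N} g = g Fin.zero + sumFin (λ i → g (Fin.suc i))

  _⊗_ : {N : ℕ} → Matrix N → Matrix N → Matrix N
  (M ⊗ M′) i j = sumFin (λ l → M i l * M′ l j)

  identity : {N : ℕ} → Matrix N
  identity i j = if does (toℕ i Data.Nat.≟ toℕ j) then 1# else 0#

  prodM : {N k : ℕ} → Vec (Matrix N) k → Matrix N
  prodM []       = identity
  prodM (M ∷ Ms) = M ⊗ prodM Ms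

  Pmat : {N : ℕ} → Matrix N
  Pmat i j = if does (toℕ j ≤? toℕ i) then 1# else 0#

  Smat : {N : ℕ} → (ℕ → Carrier) → Matrix N
  Smat f i j = if does (toℕ j ≤? toℕ i) then f (suc (toℕ i)) else 0#

  -- (A_f)_{i,j} = f(i-1) if j ≤ i-1, else 0   (1-based: i-1 = toℕ i, j = toℕ j + 1)
  Amat : {N : ℕ} → (ℕ → Carrier) → Matrix N
  Amat f i j = if does (suc (toℕ j) ≤? toℕ i) then f (toℕ i) else 0#

  mapV : {k : ℕ} {X Y : Set c} → (X → Y) → Vec X k → Vec Y k
  mapV g []       = []
  mapV g (x ∷ xs) = g x ∷ mapV g xs

-- Work with matrices indexed by ℕ (0-based, index l standing for row/column
-- l + 1) and products truncated at a size N.  Write P for the lower triangular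
-- all-ones matrix and say that a matrix X is represented by a two-argument
-- function T when  (P·X)(i,j) = [j ≤ i] · T(i+1, j+1)  for all i, j < N.
-- Three facts drive the proof:
--   * multiplying by P from the left turns row i into a partial sum over rows
--     0..i (lower-row);
--   * both S_f and A_f are rows of P rescaled by values of f, A_f also shifted
--     down by one row (S-row, A-row-zero, A-row-suc);
--   * hence if X is represented by T, then S_f·X and A_f·X are represented by
--     the nested sums with one more outer summation (S-step, A-step).
-- Starting from the identity (represented by the constant 1, via pick) an
-- induction over the list of functions shows that the products of S_f's and
-- A_f's are represented by S and A.  Reading off the corner entry i = N - 1
-- of the Fin-indexed matrices of the statement gives the theorem.
module Submission where

open import Defs
open import Level using (Level)
open import Algebra.Bundles using (CommutativeRing)
open import Data.Nat using (ℕ; suc; _≤_)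
open import Data.Fin using (Fin; toℕ; fromℕ)
open import Data.Vec using (Vec)
open import Data.Product using (_×_)

open import Data.Nat using (zero; _<_; s≤s; _≤?_; _≟_)
open import Data.Nat.Properties
  using (≤-pred; m≤n⇒m≤1+n; <⇒≤; <⇒≱; ≰⇒>; ≤∧≢⇒<; <-≤-trans; <-irrefl; ≤-antisym; n<1+n)
open import Data.Fin.Properties using (toℕ<n; toℕ-fromℕ)
open import Data.Vec using ([]; _∷_)
open import Data.Bool using (Bool; true; false; if_then_else_)
open import Data.Product using (_,_)
open import Relation.Nullary using (Dec; yes; no; does; ¬_)
open import Relation.Nullary.Negation using (contradiction)
open import Relation.Binary.PropositionalEquality as ≡ using (_≡_)

module Proof {c ℓ : Level} (R : CommutativeRing c ℓ) where
  open CommutativeRing R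
  open NestedSums R
  open import Relation.Binary.Reasoning.Setoid setoid

  if-yes : ∀ {p} {Q : Set p} (d : Dec Q) {x y : Carrier} → Q → (if does d then x else y) ≈ x
  if-yes (yes _) _ = refl
  if-yes (no ¬q) q = contradiction q ¬q

  if-no : ∀ {p} {Q : Set p} (d : Dec Q) {x y : Carrier} → ¬ Q → (if does d then x else y) ≈ y
  if-no (yes q) ¬q = contradiction q ¬q
  if-no (no _)  _  = refl

  guard-intro : ∀ {p} {Q : Set p} (d : Dec Q) {x : Carrier} → (¬ Q → x ≈ 0#) → x ≈ (if does d then x else 0#)
  guard-intro (yes _) vanish = refl
  guard-intro (no ¬q) vanish = vanish ¬q

  ≤?-suc : ∀ j l → does (suc j ≤? suc l) ≡ does (j ≤? l)
  ≤?-suc zero    l = ≡.refl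
  ≤?-suc (suc j) l = ≡.refl

  *-guard : ∀ (b : Bool) x y → x * (if b then y else 0#) ≈ (if b then x * y else 0#)
  *-guard true  x y = refl
  *-guard false x y = zeroʳ x

  guard-scale : ∀ (b : Bool) a x → (if b then a else 0#) * x ≈ a * ((if b then 1# else 0#) * x)
  guard-scale true  a x = *-congˡ (sym (*-identityˡ x))
  guard-scale false a x = trans (zeroˡ x) (sym (trans (*-congˡ (zeroˡ x)) (zeroʳ a)))

  sumBelow-cong : ∀ u {g h : ℕ → Carrier} → (∀ l → l < u → g l ≈ h l) → sumBelow u g ≈ sumBelow u h
  sumBelow-cong zero    e = refl
  sumBelow-cong (suc u) e = +-cong (sumBelow-cong u (λ l l<u → e l (m≤n⇒m≤1+n l<u))) (e u (n<1+n u))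

  sumBelow-zero : ∀ u {g : ℕ → Carrier} → (∀ l → l < u → g l ≈ 0#) → sumBelow u g ≈ 0#
  sumBelow-zero u {g} e = begin
    sumBelow u g         ≈⟨ sumBelow-cong u e ⟩
    sumBelow u (λ _ → 0#) ≈⟨ sum-of-zeros u ⟩
    0#                   ∎
    where
    sum-of-zeros : ∀ u → sumBelow u (λ _ → 0#) ≈ 0#
    sum-of-zeros zero    = refl
    sum-of-zeros (suc u) = trans (+-identityʳ _) (sum-of-zeros u)

  sumBelow-shift : ∀ u (g : ℕ → Carrier) → sumBelow (suc u) g ≈ g 0 + sumBelow u (λ l → g (suc l))
  sumBelow-shift zero    g = trans (+-identityˡ (g 0)) (sym (+-identityʳ (g 0)))
  sumBelow-shift (suc u) g = begin
    sumBelow (suc u) g + g (suc u)                   ≈⟨ +-congʳ (sumBelow-shift u g) ⟩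
    (g 0 + sumBelow u (λ l → g (suc l))) + g (suc u) ≈⟨ +-assoc _ _ _ ⟩
    g 0 + (sumBelow u (λ l → g (suc l)) + g (suc u)) ∎

  *-sumBelow : ∀ u x (g : ℕ → Carrier) → x * sumBelow u g ≈ sumBelow u (λ l → x * g l)
  *-sumBelow zero    x g = zeroʳ x
  *-sumBelow (suc u) x g = trans (distribˡ x _ _) (+-congʳ (*-sumBelow u x g))

  sumFin-cong : ∀ {N} {g h : Fin N → Carrier} → (∀ l → g l ≈ h l) → sumFin g ≈ sumFin h
  sumFin-cong {zero}  e = refl
  sumFin-cong {suc N} e = +-cong (e Fin.zero) (sumFin-cong (λ l → e (Fin.suc l)))

  sumFin-toℕ : ∀ N (g : ℕ → Carrier) → sumFin {N} (λ l → g (toℕ l)) ≈ sumBelow N g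
  sumFin-toℕ zero    g = refl
  sumFin-toℕ (suc N) g = trans (+-congˡ (sumFin-toℕ N (λ l → g (suc l)))) (sym (sumBelow-shift N g))

  Mat : Set c
  Mat = ℕ → ℕ → Carrier

  Pℕ Iℕ : Mat
  Pℕ i j = if does (j ≤? i) then 1# else 0#
  Iℕ i j = if does (i ≟ j) then 1# else 0#

  -- the matrices S_f and A_f of the statement, with Smat f = Sℕ f and Amat f = Aℕ f on Fin indices
  Sℕ Aℕ : (ℕ → Carrier) → Mat
  Sℕ f i j = if does (j ≤? i) then f (suc i) else 0#
  Aℕ f i j = if does (suc j ≤? i) then f i else 0#

  -- The summand of the outermost sum of S and A:
  -- S (f ∷ fs) N m = sumBelow (suc N) (layer f (S fs) m), and likewise for A.
  layer : (ℕ → Carrier) → (ℕ → ℕ → Carrier) → ℕ → ℕ → Carrier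
  layer f T m n = if does (m ≤? n) then f n * T n m else 0#

  layer-vanish : ∀ f T {u m} → u ≤ m → sumBelow u (layer f T m) ≈ 0#
  layer-vanish f T {u} {m} u≤m =
    sumBelow-zero u (λ n n<u → if-no (m ≤? n) (<⇒≱ (<-≤-trans n<u u≤m)))

  pick : ∀ N (h : ℕ → Carrier) {j} → j < N → sumBelow N (λ l → h l * Iℕ l j) ≈ h j
  pick (suc N) h {j} j<N+1 with N ≟ j
  ... | yes ≡.refl = trans (+-cong (sumBelow-zero N off-diagonal) diagonal) (+-identityˡ (h N))
    where
    diagonal : h N * Iℕ N N ≈ h N
    diagonal = trans (*-congˡ (if-yes (N ≟ N) ≡.refl)) (*-identityʳ (h N))
    off-diagonal : ∀ l → l < N → h l * Iℕ l N ≈ 0#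
    off-diagonal l l<N = trans (*-congˡ (if-no (l ≟ N) (λ { ≡.refl → <-irrefl ≡.refl l<N }))) (zeroʳ (h l))
  ... | no N≢j = trans (+-cong (pick N h j<N) off-diagonal) (+-identityʳ (h j))
    where
    off-diagonal : h N * Iℕ N j ≈ 0#
    off-diagonal = trans (*-congˡ (if-no (N ≟ j) N≢j)) (zeroʳ (h N))
    j<N : j < N
    j<N = ≤∧≢⇒< (≤-pred j<N+1) (λ j≡N → N≢j (≡.sym j≡N))

  lower-row : ∀ N {i} (g : ℕ → Carrier) → i < N → sumBelow N (λ l → Pℕ i l * g l) ≈ sumBelow (suc i) g
  lower-row (suc N) {i} g i<N+1 with N ≤? i
  ... | no N≰i = trans (+-cong (lower-row N g (≰⇒> N≰i)) beyond-diagonal) (+-identityʳ _)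
    where
    beyond-diagonal : Pℕ i N * g N ≈ 0#
    beyond-diagonal = trans (*-congʳ (if-no (N ≤? i) N≰i)) (zeroˡ (g N))
  ... | yes N≤i with ≤-antisym N≤i (≤-pred i<N+1)
  ... | ≡.refl = +-cong (sumBelow-cong N (λ l l<N → below-diagonal l (m≤n⇒m≤1+n l<N))) (below-diagonal N (n<1+n N))
    where
    below-diagonal : ∀ l → l < suc N → Pℕ N l * g l ≈ g l
    below-diagonal l l≤N = trans (*-congʳ (if-yes (l ≤? N) (≤-pred l≤N))) (*-identityˡ (g l))

  module Size (N : ℕ) where
    infixl 7 _·_
    _·_ : Mat → Mat → Mat
    (X · Y) i j = sumBelow N (λ l → X i l * Y l j)

    prodℕ : ∀ {k} → ((ℕ → Carrier) → Mat) → Vec (ℕ → Carrier) k → Mat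
    prodℕ M []       = Iℕ
    prodℕ M (f ∷ fs) = M f · prodℕ M fs

    S-row : ∀ f X l j → (Sℕ f · X) l j ≈ f (suc l) * (Pℕ · X) l j
    S-row f X l j = trans (sumBelow-cong N (λ l′ _ → guard-scale (does (l′ ≤? l)) _ _))
                          (sym (*-sumBelow N (f (suc l)) _))

    A-row-zero : ∀ f X j → (Aℕ f · X) 0 j ≈ 0#
    A-row-zero f X j = sumBelow-zero N (λ l′ _ → zeroˡ _)

    A-row-suc : ∀ f X l j → (Aℕ f · X) (suc l) j ≈ f (suc l) * (Pℕ · X) l j
    A-row-suc f X l j = trans (sumBelow-cong N entry) (sym (*-sumBelow N (f (suc l)) _))
      where
      entry : ∀ l′ → l′ < N → Aℕ f (suc l) l′ * X l′ j ≈ f (suc l) * (Pℕ l l′ * X l′ j)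
      entry l′ _ rewrite ≤?-suc l′ l = guard-scale (does (l′ ≤? l)) _ _

    Represents : Mat → (ℕ → ℕ → Carrier) → Set ℓ
    Represents X T = ∀ i j → i < N → j < N →
      (Pℕ · X) i j ≈ (if does (j ≤? i) then T (suc i) (suc j) else 0#)

    unit-represented : Represents Iℕ (λ _ _ → 1#)
    unit-represented i j _ j<N = pick N (Pℕ i) j<N

    row-to-layer : ∀ {X} T f → Represents X T → ∀ {l j} → l < N → j < N →
      f (suc l) * (Pℕ · X) l j ≈ layer f T (suc j) (suc l)
    row-to-layer {X} T f rep {l} {j} l<N j<N = begin
      f (suc l) * (Pℕ · X) l j
        ≈⟨ *-congˡ (rep l j l<N j<N) ⟩
      f (suc l) * (if does (j ≤? l) then T (suc l) (suc j) else 0#)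
        ≈⟨ *-guard (does (j ≤? l)) _ _ ⟩
      (if does (j ≤? l) then f (suc l) * T (suc l) (suc j) else 0#)
        ≡⟨ ≡.cong (λ b → if b then f (suc l) * T (suc l) (suc j) else 0#) (≡.sym (≤?-suc j l)) ⟩
      layer f T (suc j) (suc l) ∎

    -- Multiplying by S_f adds an outer sum over N ≥ n ≥ m (the n = 0 layer vanishes).
    S-step : ∀ {X} T f → Represents X T → Represents (Sℕ f · X) (λ M m → sumBelow (suc M) (layer f T m))
    S-step {X} T f rep i j i<N j<N = begin
      (Pℕ · (Sℕ f · X)) i j
        ≈⟨ lower-row N (λ l → (Sℕ f · X) l j) i<N ⟩
      sumBelow (suc i) (λ l → (Sℕ f · X) l j)
        ≈⟨ sumBelow-cong (suc i) (λ l l≤i → trans (S-row f X l j) (row-to-layer T f rep (<-≤-trans l≤i i<N) j<N)) ⟩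
      sumBelow (suc i) (λ l → layer f T (suc j) (suc l))
        ≈⟨ sym (trans (sumBelow-shift (suc i) _) (+-identityˡ _)) ⟩
      sumBelow (suc (suc i)) (layer f T (suc j))
        ≈⟨ guard-intro (j ≤? i) (λ j≰i → layer-vanish f T (s≤s (≰⇒> j≰i))) ⟩
      (if does (j ≤? i) then sumBelow (suc (suc i)) (layer f T (suc j)) else 0#) ∎

    A-step : ∀ {X} T f → Represents X T → Represents (Aℕ f · X) (λ M m → sumBelow M (layer f T m))
    A-step {X} T f rep i j i<N j<N = begin
      (Pℕ · (Aℕ f · X)) i j
        ≈⟨ lower-row N (λ l → (Aℕ f · X) l j) i<N ⟩
      sumBelow (suc i) (λ l → (Aℕ f · X) l j)
        ≈⟨ sumBelow-cong (suc i) (λ l l≤i → row-as-layer l (<-≤-trans l≤i i<N)) ⟩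
      sumBelow (suc i) (layer f T (suc j))
        ≈⟨ guard-intro (j ≤? i) (λ j≰i → layer-vanish f T (m≤n⇒m≤1+n (≰⇒> j≰i))) ⟩
      (if does (j ≤? i) then sumBelow (suc i) (layer f T (suc j)) else 0#) ∎
      where
      row-as-layer : ∀ l → l < N → (Aℕ f · X) l j ≈ layer f T (suc j) l
      row-as-layer zero    _     = A-row-zero f X j
      row-as-layer (suc l) l+1<N =
        trans (A-row-suc f X l j) (row-to-layer T f rep (<⇒≤ l+1<N) j<N)

    S-represented : ∀ {k} (fs : Vec (ℕ → Carrier) k) → Represents (prodℕ Sℕ fs) (S fs)
    S-represented []       = unit-represented
    S-represented (f ∷ fs) = S-step (S fs) f (S-represented fs)

    A-represented : ∀ {k} (fs : Vec (ℕ → Carrier) k) → Represents (prodℕ Aℕ fs) (A fs)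
    A-represented []       = unit-represented
    A-represented (f ∷ fs) = A-step (A fs) f (A-represented fs)

  restrict : (N : ℕ) → Mat → Matrix N
  restrict N X i j = X (toℕ i) (toℕ j)

  restrict-prod : ∀ {N k} (M : (ℕ → Carrier) → Mat) (fs : Vec (ℕ → Carrier) k) i j →
    prodM (mapV (λ f → restrict N (M f)) fs) i j ≈ Size.prodℕ N M fs (toℕ i) (toℕ j)
  restrict-prod     M []       i j = refl
  restrict-prod {N} M (f ∷ fs) i j =
    trans (sumFin-cong (λ l → *-congˡ (restrict-prod M fs l j)))
          (sumFin-toℕ N (λ l → M f (toℕ i) l * Size.prodℕ N M fs l (toℕ j)))

  module Corner (n : ℕ) where
    open Size (suc n)

    P-last-row : (l : Fin (suc n)) → Pmat {suc n} (fromℕ n) l ≈ Pℕ n (toℕ l)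
    P-last-row l rewrite toℕ-fromℕ n = refl

    corner : ∀ {k} (M : (ℕ → Carrier) → Mat) (fs : Vec (ℕ → Carrier) k) (j : Fin (suc n)) →
      (Pmat ⊗ prodM (mapV (λ f → restrict (suc n) (M f)) fs)) (fromℕ n) j ≈ (Pℕ · prodℕ M fs) n (toℕ j)
    corner M fs j =
      trans (sumFin-cong (λ l → *-cong (P-last-row l) (restrict-prod M fs l j)))
            (sumFin-toℕ (suc n) (λ l → Pℕ n l * prodℕ M fs l (toℕ j)))

    read-corner : ∀ {k} (M : (ℕ → Carrier) → Mat) (fs : Vec (ℕ → Carrier) k) T →
      Represents (prodℕ M fs) T → (j : Fin (suc n)) →
      T (suc n) (suc (toℕ j)) ≈ (Pmat ⊗ prodM (mapV (λ f → restrict (suc n) (M f)) fs)) (fromℕ n) j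
    read-corner M fs T rep j = sym (begin
      (Pmat ⊗ prodM (mapV (λ f → restrict (suc n) (M f)) fs)) (fromℕ n) j
        ≈⟨ corner M fs j ⟩
      (Pℕ · prodℕ M fs) n (toℕ j)
        ≈⟨ rep n (toℕ j) (n<1+n n) (toℕ<n j) ⟩
      (if does (toℕ j ≤? n) then T (suc n) (suc (toℕ j)) else 0#)
        ≈⟨ if-yes (toℕ j ≤? n) (≤-pred (toℕ<n j)) ⟩
      T (suc n) (suc (toℕ j)) ∎)

mainTheorem1 : {c ℓ : Level} (R : CommutativeRing c ℓ) →
    let open CommutativeRing R in
    let open NestedSums R in
    (n : ℕ) (k : ℕ) → 1 ≤ k → (fs : Vec (ℕ → Carrier) k) → (j : Fin (suc n)) →
    (S fs (suc n) (suc (toℕ j)) ≈ (Pmat ⊗ prodM (mapV Smat fs)) (fromℕ n) j)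
    × (A fs (suc n) (suc (toℕ j)) ≈ (Pmat ⊗ prodM (mapV Amat fs)) (fromℕ n) j)
mainTheorem1 R n k _ fs j =
  read-corner Sℕ fs (NestedSums.S R fs) (S-represented fs) j ,
  read-corner Aℕ fs (NestedSums.A R fs) (A-represented fs) j
  where
  open Proof R
  open Size (suc n)
  open Corner n
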